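{- For every integer $k\ge 4$ we have $n_2(k,3,2)\le 2k$.
   Context: An $[n,k,d]_q$-code is a $k$-dimensional subspace of $\mathbb{F}_q^n$ with minimum Hamming distance at least $d$. A linear code $C\subseteq\mathbb{F}_q^n$ has locality $r$ if for every coordinate $i$ there is a set $S_i\subseteq\{1,\dots,n\}\setminus\{i\}$ with $|S_i|\le r$ such that any two codewords agreeing on all coordinates in $S_i$ also agree in coordinate $i$. $n_q(k,d,r)$ denotes the minimum length $n$ of an $[n,k,d]_q$-code with locality $r$. -}

module Defs where

open import Data.Bool using (Bool; true; false; _xor_; _∧_; if_then_else_)
open import Data.Nat using (ℕ; zero; suc; _+_; _≤_)
open import Data.Fin using (Fin; zero; suc)
open import Data.Fin.Subset using (Subset; _∈_; _∉_; ∣_∣)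
open import Data.Product using (Σ; ∃; _×_)
open import Relation.Binary.PropositionalEquality using (_≡_; _≢_)

-- The field F_2 is modelled by Bool: addition = xor, multiplication = ∧.
-- A word of length n over F_2 is a function Fin n → Bool.
Word : ℕ → Set
Word n = Fin n → Bool

xorSum : ∀ {k} → (Fin k → Bool) → Bool
xorSum {zero}  f = false
xorSum {suc k} f = f zero xor xorSum (λ i → f (suc i))

weight : ∀ {n} → Word n → ℕ
weight {zero}  w = 0
weight {suc n} w = (if w zero then 1 else 0) + weight (λ i → w (suc i))

dist : ∀ {n} → Word n → Word n → ℕ
dist a b = weight (λ i → a i xor b i)

GenMatrix : ℕ → ℕ → Set
GenMatrix k n = Fin k → Fin n → Bool

-- Encoding a message x ∈ F_2^k: the codeword x G.  The code is the row space
-- {encode G x | x ∈ F_2^k}.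
encode : ∀ {k n} → GenMatrix k n → Word k → Word n
encode G x j = xorSum (λ i → x i ∧ G i j)

LinIndep : ∀ {k n} → GenMatrix k n → Set
LinIndep {k} {n} G = (x : Word k) → (∀ j → encode G x j ≡ false) → ∀ i → x i ≡ false

MinDistAtLeast : ∀ {k n} → GenMatrix k n → ℕ → Set
MinDistAtLeast {k} {n} G d =
  (x y : Word k) → (∃ λ j → encode G x j ≢ encode G y j) →
  d ≤ dist (encode G x) (encode G y)

HasLocality : ∀ {k n} → GenMatrix k n → ℕ → Set
HasLocality {k} {n} G r =
  (i : Fin n) → Σ (Subset n) λ S →
    (i ∉ S) × (∣ S ∣ ≤ r) ×
    ((x y : Word k) → (∀ j → j ∈ S → encode G x j ≡ encode G y j) →
      encode G x i ≡ encode G y i)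

IsLRC : ∀ {k n} → GenMatrix k n → ℕ → ℕ → Set
IsLRC G d r = LinIndep G × MinDistAtLeast G d × HasLocality G r

{-# OPTIONS --safe #-}
-- Take the systematic code x ↦ (x , (x_{t-1} + x_t)_t) of length 2k, indices t taken cyclically
-- mod k.  Each parity symbol forms, with the two message symbols it involves, a parity
-- check of weight 3, so every coordinate is determined by two others.  A message x has a
-- codeword of weight wt(x) plus the number of cyclic changes of x.  A nonconstant cyclic
-- binary sequence changes at least twice, so a nonconstant x gives weight ≥ 1 + 2; the only
-- nonzero constant message is all-ones, of weight k ≥ 3.
module Submission where

open import Defs
open import Data.Nat using (ℕ; _≤_; _*_)
open import Data.Product using (Σ; _×_)

open import Algebra.Bundles using (CommutativeRing)
open import Data.Bool using (Bool; true; false; _xor_; _∧_)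
open import Data.Bool.Properties
  using (_≟_; xor-assoc; xor-same; xor-identityʳ; xor-inverseˡ; ¬-not; xor-∧-commutativeRing;
         ∧-identityʳ; ∧-zeroʳ; ∧-distribˡ-xor; ∧-distribʳ-xor)
open import Algebra.Properties.CommutativeSemigroup (CommutativeRing.+-commutativeSemigroup xor-∧-commutativeRing)
  using (interchange)
open import Data.Fin using (Fin; zero; suc; fromℕ; inject₁; toℕ; _↑ˡ_; _↑ʳ_; splitAt; join)
open import Data.Fin.Properties
  using (suc-injective; toℕ-inject₁; ↑ˡ-injective; join-splitAt; all?; ¬∀⟶∃¬)
open import Data.Fin.Subset using (Subset; _∈_; _∉_; ∣_∣; ⁅_⁆; _∪_)
open import Data.Fin.Subset.Properties using (∣⁅x⁆∣≡1; x∈p∪q⁻; x∈p∪q⁺; x∈⁅y⁆⇒x≡y; x∈⁅x⁆)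
open import Data.Nat using (zero; suc; _+_; z≤n; s≤s)
open import Data.Nat.Properties
  using (≤-trans; ≤-reflexive; +-mono-≤; +-monoʳ-≤; m≤m+n; m≤n+m; n≤1+n; +-suc; +-identityʳ;
         <⇒≤; 1+n≢n; module ≤-Reasoning)
open import Data.Product using (_,_)
open import Data.Sum using (inj₁; inj₂; [_,_])
open import Data.Vec using ([]; _∷_)
open import Data.Vec.Functional using (_++_; tail)
open import Data.Vec.Functional.Properties using (lookup-++ˡ; lookup-++ʳ)
open import Function using (_∘_)
open import Relation.Nullary using (yes; no; contradiction)
open import Relation.Binary.PropositionalEquality
  using (_≡_; _≢_; refl; sym; trans; cong; cong₂; subst; module ≡-Reasoning)
infixl 6 _⊕_
_⊕_ : ∀ {n} → Word n → Word n → Word n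
(u ⊕ v) i = u i xor v i

infix 7 _·_
_·_ : ∀ {k} → Word k → Word k → Bool
x · c = xorSum (λ i → x i ∧ c i)

unit : ∀ {k} → Fin k → Word k
unit zero    zero    = true
unit zero    (suc _) = false
unit (suc _) zero    = false
unit (suc i) (suc j) = unit i j

xor-≢ : ∀ {a b} → a ≢ b → a xor b ≡ true
xor-≢ {a} {b} a≢b = trans (cong (_xor b) (¬-not a≢b)) (xor-inverseˡ b)

xorSum-cong : ∀ {k} {f g : Fin k → Bool} → (∀ i → f i ≡ g i) → xorSum f ≡ xorSum g
xorSum-cong {zero}  f≗g = refl
xorSum-cong {suc k} f≗g = cong₂ _xor_ (f≗g zero) (xorSum-cong (f≗g ∘ suc))

xorSum-⊕ : ∀ {k} (f g : Fin k → Bool) → xorSum (f ⊕ g) ≡ xorSum f xor xorSum g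
xorSum-⊕ {zero}  f g = refl
xorSum-⊕ {suc k} f g = begin
  (f zero xor g zero) xor xorSum (tail f ⊕ tail g)
    ≡⟨ cong ((f zero xor g zero) xor_) (xorSum-⊕ (tail f) (tail g)) ⟩
  (f zero xor g zero) xor (xorSum (tail f) xor xorSum (tail g))
    ≡⟨ interchange (f zero) (g zero) (xorSum (tail f)) (xorSum (tail g)) ⟩
  (f zero xor xorSum (tail f)) xor (g zero xor xorSum (tail g))
    ∎
  where open ≡-Reasoning

·-zeroʳ : ∀ {k} (x : Word k) → x · (λ _ → false) ≡ false
·-zeroʳ {zero}  x = refl
·-zeroʳ {suc k} x rewrite ∧-zeroʳ (x zero) = ·-zeroʳ (tail x)

·-unit : ∀ {k} (x : Word k) i → x · unit i ≡ x i
·-unit {suc k} x zero rewrite ∧-identityʳ (x zero) | ·-zeroʳ (tail x) = xor-identityʳ (x zero)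
·-unit {suc k} x (suc i) rewrite ∧-zeroʳ (x zero) = ·-unit (tail x) i

·-distribˡ-⊕ : ∀ {k} (x u v : Word k) → x · (u ⊕ v) ≡ x · u xor x · v
·-distribˡ-⊕ x u v = trans (xorSum-cong (λ i → ∧-distribˡ-xor (x i) (u i) (v i)))
                           (xorSum-⊕ (λ i → x i ∧ u i) (λ i → x i ∧ v i))

·-distribʳ-⊕ : ∀ {k} (x y c : Word k) → (x ⊕ y) · c ≡ x · c xor y · c
·-distribʳ-⊕ x y c = trans (xorSum-cong (λ i → ∧-distribʳ-xor (c i) (x i) (y i)))
                           (xorSum-⊕ (λ i → x i ∧ c i) (λ i → y i ∧ c i))

encode-⊕ : ∀ {k n} (G : GenMatrix k n) (x y : Word k) j →
           encode G (x ⊕ y) j ≡ encode G x j xor encode G y j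
encode-⊕ G x y j = ·-distribʳ-⊕ x y (λ i → G i j)

encode-cong : ∀ {k n} (G : GenMatrix k n) {x y : Word k} → (∀ i → x i ≡ y i) →
              ∀ j → encode G x j ≡ encode G y j
encode-cong G x≗y j = xorSum-cong (λ i → cong (_∧ G i j) (x≗y i))

weight-cong : ∀ {n} {u v : Word n} → (∀ i → u i ≡ v i) → weight u ≡ weight v
weight-cong {zero}  u≗v = refl
weight-cong {suc n} u≗v rewrite u≗v zero = cong (_ +_) (weight-cong (u≗v ∘ suc))

weight-↑ : ∀ m {n} (w : Word (m + n)) →
           weight w ≡ weight (λ i → w (i ↑ˡ n)) + weight (λ j → w (m ↑ʳ j))
weight-↑ zero    w = refl
weight-↑ (suc m) w with w zero
... | true  = cong suc (weight-↑ m (tail w))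
... | false = weight-↑ m (tail w)

weight-head : ∀ {n} (w : Word (suc n)) → w zero ≡ true → weight w ≡ suc (weight (tail w))
weight-head w w₀≡true rewrite w₀≡true = refl

weight-tail≤ : ∀ {n} (w : Word (suc n)) → weight (tail w) ≤ weight w
weight-tail≤ w = m≤n+m _ _

weight-pos : ∀ {n} (w : Word n) i → w i ≡ true → 1 ≤ weight w
weight-pos w zero    wᵢ≡true = subst (1 ≤_) (sym (weight-head w wᵢ≡true)) (s≤s z≤n)
weight-pos w (suc i) wᵢ≡true = ≤-trans (weight-pos (tail w) i wᵢ≡true) (weight-tail≤ w)

weight-all-true : ∀ {n} (w : Word n) → (∀ i → w i ≡ true) → weight w ≡ n
weight-all-true {zero}  w w≗true = refl
weight-all-true {suc n} w w≗true =
  trans (weight-head w (w≗true zero)) (cong suc (weight-all-true (tail w) (w≗true ∘ suc)))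

Δ : ∀ {n} → Word (suc n) → Word n
Δ y i = y (inject₁ i) xor y (suc i)

Δ-weight≥1 : ∀ {n} (y : Word (suc n)) j → y zero ≢ y j → 1 ≤ weight (Δ y)
Δ-weight≥1 y zero y₀≢y₀ = contradiction refl y₀≢y₀
Δ-weight≥1 {suc n} y (suc j) y₀≢yⱼ with y zero ≟ y (suc zero)
... | yes y₀≡y₁ = ≤-trans (Δ-weight≥1 (tail y) j (y₀≢yⱼ ∘ trans y₀≡y₁)) (weight-tail≤ (Δ y))
... | no  y₀≢y₁ = weight-pos (Δ y) zero (xor-≢ y₀≢y₁)

Δ-weight≥2 : ∀ {n} (y : Word (suc n)) j → y zero ≡ y (fromℕ n) → y zero ≢ y j →
             2 ≤ weight (Δ y)
Δ-weight≥2 y zero closed y₀≢y₀ = contradiction refl y₀≢y₀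
Δ-weight≥2 {suc n} y (suc j) closed y₀≢yⱼ with y zero ≟ y (suc zero)
... | yes y₀≡y₁ =
  ≤-trans (Δ-weight≥2 (tail y) j (trans (sym y₀≡y₁) closed) (y₀≢yⱼ ∘ trans y₀≡y₁))
          (weight-tail≤ (Δ y))
... | no  y₀≢y₁ =
  ≤-trans (s≤s (Δ-weight≥1 (tail y) (fromℕ n) (λ y₁≡yₙ → y₀≢y₁ (trans closed (sym y₁≡yₙ)))))
          (≤-reflexive (sym (weight-head (Δ y) (xor-≢ y₀≢y₁))))

prev : ∀ {m} → Fin (suc m) → Fin (suc m)
prev zero    = fromℕ _
prev (suc i) = inject₁ i

prev-≢ : ∀ {m} (t : Fin (suc (suc m))) → prev t ≢ t
prev-≢ zero    ()
prev-≢ (suc i) eq = 1+n≢n (trans (sym (cong toℕ eq)) (toℕ-inject₁ i))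

cyclicΔ : ∀ {m} → Word (suc m) → Word (suc m)
cyclicΔ x t = x (prev t) xor x t

cyclicΔ-weight≥2 : ∀ {m} (x : Word (suc m)) j → x zero ≢ x j → 2 ≤ weight (cyclicΔ x)
cyclicΔ-weight≥2 {m} x j x₀≢xⱼ with x (fromℕ m) ≟ x zero
... | yes closed = ≤-trans (Δ-weight≥2 x j (sym closed) x₀≢xⱼ) (weight-tail≤ (cyclicΔ x))
... | no  unclosed =
  ≤-trans (s≤s (Δ-weight≥1 x (fromℕ m) (unclosed ∘ sym)))
          (≤-reflexive (sym (weight-head (cyclicΔ x) (xor-≢ unclosed))))

weight+cyclicΔ-weight≥3 : ∀ {m} → 2 ≤ m → ∀ (z : Word (suc m)) i → z i ≡ true →
                          3 ≤ weight z + weight (cyclicΔ z)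
weight+cyclicΔ-weight≥3 {m} 2≤m z i zᵢ≡true with all? (λ j → z j ≟ z zero)
... | yes constant = begin
  3                               ≤⟨ s≤s 2≤m ⟩
  suc m                           ≡⟨ weight-all-true z z≗true ⟨
  weight z                        ≤⟨ m≤m+n _ _ ⟩
  weight z + weight (cyclicΔ z)   ∎
  where
  open ≤-Reasoning

  z≗true : ∀ j → z j ≡ true
  z≗true j = trans (constant j) (trans (sym (constant i)) zᵢ≡true)
... | no  nonconstant with ¬∀⟶∃¬ (suc m) _ (λ j → z j ≟ z zero) nonconstant
...   | j , zⱼ≢z₀ = +-mono-≤ (weight-pos z i zᵢ≡true) (cyclicΔ-weight≥2 z j (zⱼ≢z₀ ∘ sym))

∣p∪q∣≤∣p∣+∣q∣ : ∀ {n} (p q : Subset n) → ∣ p ∪ q ∣ ≤ ∣ p ∣ + ∣ q ∣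
∣p∪q∣≤∣p∣+∣q∣ []          []          = z≤n
∣p∪q∣≤∣p∣+∣q∣ (true  ∷ p) (true  ∷ q) =
  s≤s (≤-trans (∣p∪q∣≤∣p∣+∣q∣ p q) (+-monoʳ-≤ ∣ p ∣ (n≤1+n ∣ q ∣)))
∣p∪q∣≤∣p∣+∣q∣ (true  ∷ p) (false ∷ q) = s≤s (∣p∪q∣≤∣p∣+∣q∣ p q)
∣p∪q∣≤∣p∣+∣q∣ (false ∷ p) (true  ∷ q) =
  ≤-trans (s≤s (∣p∪q∣≤∣p∣+∣q∣ p q)) (≤-reflexive (sym (+-suc ∣ p ∣ ∣ q ∣)))
∣p∪q∣≤∣p∣+∣q∣ (false ∷ p) (false ∷ q) = ∣p∪q∣≤∣p∣+∣q∣ p q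

RecoverableFrom : ∀ {k n} → GenMatrix k n → Fin n → Subset n → Set
RecoverableFrom {k} G i S =
  (x y : Word k) → (∀ j → j ∈ S → encode G x j ≡ encode G y j) → encode G x i ≡ encode G y i

LocalAt : ∀ {k n} → GenMatrix k n → ℕ → Fin n → Set
LocalAt {n = n} G r i = Σ (Subset n) λ S → (i ∉ S) × (∣ S ∣ ≤ r) × RecoverableFrom G i S

localAt-parityCheck : ∀ {k n} (G : GenMatrix k n) {i a b : Fin n} → i ≢ a → i ≢ b →
                      (∀ x → encode G x i ≡ encode G x a xor encode G x b) → LocalAt G 2 i
localAt-parityCheck G {i} {a} {b} i≢a i≢b check = ⁅ a ⁆ ∪ ⁅ b ⁆ , i∉S , ∣S∣≤2 , recover
  where
  i∉S : i ∉ ⁅ a ⁆ ∪ ⁅ b ⁆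
  i∉S i∈S = [ i≢a ∘ x∈⁅y⁆⇒x≡y a , i≢b ∘ x∈⁅y⁆⇒x≡y b ] (x∈p∪q⁻ ⁅ a ⁆ ⁅ b ⁆ i∈S)

  ∣S∣≤2 : ∣ ⁅ a ⁆ ∪ ⁅ b ⁆ ∣ ≤ 2
  ∣S∣≤2 = ≤-trans (∣p∪q∣≤∣p∣+∣q∣ ⁅ a ⁆ ⁅ b ⁆) (≤-reflexive (cong₂ _+_ (∣⁅x⁆∣≡1 a) (∣⁅x⁆∣≡1 b)))

  recover : RecoverableFrom G i (⁅ a ⁆ ∪ ⁅ b ⁆)
  recover x y agree = begin
    encode G x i                  ≡⟨ check x ⟩
    encode G x a xor encode G x b ≡⟨ cong₂ _xor_ (agree a (x∈p∪q⁺ (inj₁ (x∈⁅x⁆ a))))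
                                                 (agree b (x∈p∪q⁺ (inj₂ (x∈⁅x⁆ b)))) ⟩
    encode G y a xor encode G y b ≡⟨ check y ⟨
    encode G y i                  ∎
    where open ≡-Reasoning

hasLocality-↑ : ∀ {k} m {n} (G : GenMatrix k (m + n)) r →
                (∀ i → LocalAt G r (i ↑ˡ n)) → (∀ j → LocalAt G r (m ↑ʳ j)) → HasLocality G r
hasLocality-↑ m {n} G r left right i = subst (LocalAt G r) (join-splitAt m n i)
  ([_,_] {C = LocalAt G r ∘ join m n} left right (splitAt m i))

minWeight⇒minDist : ∀ {k n} (G : GenMatrix k n) d →
                    (∀ z i → z i ≡ true → d ≤ weight (encode G z)) → MinDistAtLeast G d
minWeight⇒minDist {k} G d heavy x y (j , xⱼ≢yⱼ) with all? (λ i → x i ≟ y i)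
... | yes x≗y = contradiction (encode-cong G x≗y j) xⱼ≢yⱼ
... | no  x≉y with ¬∀⟶∃¬ k _ (λ i → x i ≟ y i) x≉y
...   | i , xᵢ≢yᵢ =
  subst (d ≤_) (weight-cong (encode-⊕ G x y)) (heavy (x ⊕ y) i (xor-≢ xᵢ≢yᵢ))

↑ˡ≢↑ʳ : ∀ {m n} (i : Fin m) (j : Fin n) → i ↑ˡ n ≢ m ↑ʳ j
↑ˡ≢↑ʳ zero    j ()
↑ˡ≢↑ʳ (suc i) j eq = ↑ˡ≢↑ʳ i j (suc-injective eq)

cyclicCode : ∀ m → GenMatrix (suc m) (suc m + suc m)
cyclicCode m i j = (unit ++ λ t → unit (prev t) ⊕ unit t) j i

module _ {m : ℕ} where

  private
    k : ℕ
    k = suc m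

    G : GenMatrix k (k + k)
    G = cyclicCode m

  encode-systematic : ∀ x t → encode G x (t ↑ˡ k) ≡ x t
  encode-systematic x t =
    trans (cong (x ·_) (lookup-++ˡ unit (λ s → unit (prev s) ⊕ unit s) t)) (·-unit x t)

  encode-parity : ∀ x t → encode G x (k ↑ʳ t) ≡ x (prev t) xor x t
  encode-parity x t = begin
    encode G x (k ↑ʳ t)
      ≡⟨ cong (x ·_) (lookup-++ʳ unit (λ s → unit (prev s) ⊕ unit s) t) ⟩
    x · (unit (prev t) ⊕ unit t)      ≡⟨ ·-distribˡ-⊕ x (unit (prev t)) (unit t) ⟩
    x · unit (prev t) xor x · unit t  ≡⟨ cong₂ _xor_ (·-unit x (prev t)) (·-unit x t) ⟩
    x (prev t) xor x t                ∎
    where open ≡-Reasoning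

  weight-encode : ∀ x → weight (encode G x) ≡ weight x + weight (cyclicΔ x)
  weight-encode x = trans (weight-↑ k (encode G x))
    (cong₂ _+_ (weight-cong (encode-systematic x)) (weight-cong (encode-parity x)))

  cyclicCode-linIndep : LinIndep G
  cyclicCode-linIndep x encode≗false i =
    trans (sym (encode-systematic x i)) (encode≗false (i ↑ˡ k))

  cyclicCode-minDist : 2 ≤ m → MinDistAtLeast G 3
  cyclicCode-minDist 2≤m = minWeight⇒minDist G 3 λ z i zᵢ≡true →
    subst (3 ≤_) (sym (weight-encode z)) (weight+cyclicΔ-weight≥3 2≤m z i zᵢ≡true)

cyclicCode-hasLocality : ∀ m → HasLocality (cyclicCode (suc m)) 2
cyclicCode-hasLocality m = hasLocality-↑ k G 2 systematic parity
  where
  open ≡-Reasoning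

  k : ℕ
  k = suc (suc m)

  G : GenMatrix k (k + k)
  G = cyclicCode (suc m)

  systematic : ∀ t → LocalAt G 2 (t ↑ˡ k)
  systematic t =
    localAt-parityCheck G (prev-≢ t ∘ sym ∘ ↑ˡ-injective k t (prev t)) (↑ˡ≢↑ʳ t t) λ x →
      let p = x (prev t) in begin
      encode G x (t ↑ˡ k)                          ≡⟨ encode-systematic x t ⟩
      x t                                          ≡⟨ cong (_xor x t) (xor-same p) ⟨
      (p xor p) xor x t                            ≡⟨ xor-assoc p p (x t) ⟩
      p xor (p xor x t)                            ≡⟨ cong₂ _xor_ (encode-systematic x (prev t))
                                                                  (encode-parity x t) ⟨
      encode G x (prev t ↑ˡ k) xor encode G x (k ↑ʳ t) ∎

  parity : ∀ t → LocalAt G 2 (k ↑ʳ t)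
  parity t =
    localAt-parityCheck G (↑ˡ≢↑ʳ (prev t) t ∘ sym) (↑ˡ≢↑ʳ t t ∘ sym) λ x →
      trans (encode-parity x t)
            (sym (cong₂ _xor_ (encode-systematic x (prev t)) (encode-systematic x t)))

cyclicCode-isLRC : ∀ {m} → 2 ≤ m → IsLRC (cyclicCode m) 3 2
cyclicCode-isLRC {suc m} 2≤1+m =
  cyclicCode-linIndep , cyclicCode-minDist 2≤1+m , cyclicCode-hasLocality m

lemma26 : (k : ℕ) → 4 ≤ k →
    Σ ℕ λ n → (n ≤ 2 * k) × Σ (GenMatrix k n) λ G → IsLRC G 3 2
lemma26 (suc m) (s≤s 3≤m) =
  suc m + suc m , ≤-reflexive (cong (suc m +_) (sym (+-identityʳ (suc m)))) ,
  cyclicCode m , cyclicCode-isLRC (<⇒≤ 3≤m)
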